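{- Let $t$ be a positive integer and let $M$ be a matroid with the $(t,2t)$-property. If $(S_1,\dots,S_n)$ is a $t$-echidna of $M$ with $n \ge 3t-1$, then $(S_1,\dots,S_n)$ is also a $t$-coechidna of $M$.
   Context: A matroid $M$ has the $(t,\ell)$-property if every $t$-element subset of $E(M)$ is contained in both an $\ell$-element circuit and an $\ell$-element cocircuit of $M$. A $t$-echidna of order $n$ of $M$ is a partition $(S_1,\dots,S_n)$ of a subset of $E(M)$ such that $|S_i|=2$ for all $i\in\{1,\dots,n\}$ and $\bigcup_{i\in I} S_i$ is a circuit of $M$ for every $I\subseteq\{1,\dots,n\}$ with $|I|=t$. It is a $t$-coechidna of $M$ if it is a $t$-echidna of the dual matroid $M^*$ (i.e. each such union is a cocircuit of $M$). -}

module Defs where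

open import Level using (Level; suc; _⊔_) renaming (zero to lzero)
open import Data.Nat using (ℕ; _<_)
open import Data.Fin using (Fin)
open import Data.Fin.Subset
open import Data.Fin.Subset.Properties using (_∈?_)
open import Data.List using (List; map; filter; allFin)
open import Data.Product using (Σ; ∃; ∃-syntax; _×_; _,_)
open import Relation.Nullary using (¬_)
open import Relation.Binary.PropositionalEquality using (_≡_; _≢_)

record Matroid (m : ℕ) : Set₁ where
  field
    Indep        : Subset m → Set
    indep-empty  : Indep ⊥
    indep-subset : ∀ {I J} → Indep J → I ⊆ J → Indep I
    indep-augment : ∀ {I J} → Indep I → Indep J → ∣ I ∣ < ∣ J ∣ →
                    ∃[ x ] (x ∈ J × x ∉ I × Indep (I ∪ ⁅ x ⁆))

module _ {m : ℕ} (M : Matroid m) where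
  open Matroid M

  IsBasis : Subset m → Set
  IsBasis B = Indep B × (∀ J → Indep J → B ⊆ J → J ≡ B)

  IsCircuit : Subset m → Set
  IsCircuit C = ¬ Indep C × (∀ D → D ⊂ C → Indep D)

  DualIndep : Subset m → Set
  DualIndep I = ∃[ B ] (IsBasis B × I ⊆ ∁ B)

  IsCocircuit : Subset m → Set
  IsCocircuit C = ¬ DualIndep C × (∀ D → D ⊂ C → DualIndep D)

  HasProperty : ℕ → ℕ → Set
  HasProperty t ℓ = ∀ X → ∣ X ∣ ≡ t →
       (∃[ C ] (IsCircuit C × X ⊆ C × ∣ C ∣ ≡ ℓ))
     × (∃[ D ] (IsCocircuit D × X ⊆ D × ∣ D ∣ ≡ ℓ))

⋃[_]_ : ∀ {n m} → Subset n → (Fin n → Subset m) → Subset m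
⋃[_]_ {n} I S = ⋃ (map S (filter (_∈? I) (allFin n)))

IsPairPartition : ∀ {n m} → (Fin n → Subset m) → Set
IsPairPartition {n} S =
  (∀ i → ∣ S i ∣ ≡ 2) × (∀ i j → i ≢ j → Empty (S i ∩ S j))

module _ {m : ℕ} (M : Matroid m) where
  IsEchidna : ℕ → ∀ {n} → (Fin n → Subset m) → Set
  IsEchidna t {n} S = IsPairPartition S ×
    (∀ (I : Subset n) → ∣ I ∣ ≡ t → IsCircuit M (⋃[ I ] S))

  IsCoechidna : ℕ → ∀ {n} → (Fin n → Subset m) → Set
  IsCoechidna t {n} S = IsPairPartition S ×
    (∀ (I : Subset n) → ∣ I ∣ ≡ t → IsCocircuit M (⋃[ I ] S))

module Submission where

-- Fix a t-set I of indices and pick one element rᵢ ∈ Sᵢ for each i ∈ I.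
-- By the (t,2t)-property the t-set {rᵢ : i ∈ I} lies in a cocircuit D
-- with |D| = 2t.  Since the blocks are disjoint, at most |D| = 2t of
-- them meet D, so at least n − 2t ≥ t − 1 blocks avoid D; let R be t − 1
-- of them.  For i ∈ I the circuit ⋃_{R ∪ {i}} S meets D inside Sᵢ only;
-- if Sᵢ ⊄ D this intersection is the single element rᵢ, contradicting
-- orthogonality of circuits and cocircuits.  Hence Sᵢ ⊆ D for all
-- i ∈ I, and comparing sizes, ⋃_I S = D is a cocircuit.

open import Defs
open import Function using (_∘_)
open import Data.Nat using (ℕ; zero; suc; _+_; _*_; _∸_; _≤_; _<_; z≤n; s≤s; s≤s⁻¹; _≤?_)
open import Data.Nat.Properties
open import Data.Fin using (Fin; zero; suc)
open import Data.Fin.Properties using () renaming (_≟_ to _≟ᶠ_; suc-injective to Fin-suc-injective)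
open import Data.Fin.Subset
open import Data.Fin.Subset.Properties
open import Data.Vec using (_∷_; []; _[_]=_)
open Data.Vec._[_]=_
open import Data.List as List using (List; filter; allFin)
import Data.List.Relation.Unary.Any as Any
open import Data.List.Membership.Propositional using () renaming (_∈_ to _∈ₗ_)
open import Data.List.Membership.Propositional.Properties using (∈-map∘filter⁻; ∈-map∘filter⁺; ∈-allFin)
open import Data.Product using (∃-syntax; _×_; _,_; proj₁; proj₂)
open import Data.Sum using (inj₁; inj₂; [_,_])
open import Data.Empty using (⊥-elim)
open import Relation.Nullary using (¬_; Dec; yes; no; contradiction)
open import Relation.Binary.PropositionalEquality using (_≡_; _≢_; refl; sym; trans; cong; subst; module ≡-Reasoning)

⊆-card-≡ : ∀ {n} {p q : Subset n} → p ⊆ q → ∣ q ∣ ≤ ∣ p ∣ → p ≡ q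
⊆-card-≡ {p = p} {q} p⊆q ∣q∣≤∣p∣ = ⊆-antisym p⊆q q⊆p
  where
  q⊆p : q ⊆ p
  q⊆p {x} x∈q with x ∈? p
  ... | yes x∈p = x∈p
  ... | no  x∉p = contradiction (p⊂q⇒∣p∣<∣q∣ (p⊆q , x , x∈q , x∉p)) (≤⇒≯ ∣q∣≤∣p∣)

∪-least : ∀ {n} {p q r : Subset n} → p ⊆ r → q ⊆ r → p ∪ q ⊆ r
∪-least {p = p} {q} p⊆r q⊆r x∈p∪q = [ p⊆r , q⊆r ] (x∈p∪q⁻ p q x∈p∪q)

⁅x⁆⊆ : ∀ {n} {x : Fin n} {p : Subset n} → x ∈ p → ⁅ x ⁆ ⊆ p
⁅x⁆⊆ {x = x} {p} x∈p y∈⁅x⁆ = subst (_∈ p) (sym (x∈⁅y⁆⇒x≡y x y∈⁅x⁆)) x∈p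

member⇒0<∣p∣ : ∀ {n} {x : Fin n} {p : Subset n} → x ∈ p → 0 < ∣ p ∣
member⇒0<∣p∣ x∈p = ≤-<-trans z≤n (x∈p⇒∣p-x∣<∣p∣ x∈p)

0<∣p∣⇒nonempty : ∀ {n} (p : Subset n) → 0 < ∣ p ∣ → Nonempty p
0<∣p∣⇒nonempty {n} p 0<∣p∣ with nonempty? p
... | yes p≠∅ = p≠∅
... | no  p=∅ = contradiction 0<∣p∣ (<-irrefl (sym (trans (cong ∣_∣ (Empty-unique p=∅)) (∣⊥∣≡0 n))))

∣p∣≤1⇒unique : ∀ {n} {p : Subset n} {x y : Fin n} → ∣ p ∣ ≤ 1 → x ∈ p → y ∈ p → x ≡ y
∣p∣≤1⇒unique {x = x} {y} ∣p∣≤1 x∈p y∈p with x ≟ᶠ y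
... | yes x≡y = x≡y
... | no  x≢y = contradiction (≤-<-trans (member⇒0<∣p∣ (x∈p∧x≢y⇒x∈p-y x∈p x≢y))
                                        (<-≤-trans (x∈p⇒∣p-x∣<∣p∣ y∈p) ∣p∣≤1))
                             (<-irrefl refl)

∣p∪q∣≤∣p∣+∣q∣ : ∀ {n} (p q : Subset n) → ∣ p ∪ q ∣ ≤ ∣ p ∣ + ∣ q ∣
∣p∪q∣≤∣p∣+∣q∣ []            []            = z≤n
∣p∪q∣≤∣p∣+∣q∣ (outside ∷ p) (outside ∷ q) = ∣p∪q∣≤∣p∣+∣q∣ p q
∣p∪q∣≤∣p∣+∣q∣ (outside ∷ p) (inside  ∷ q) =
  ≤-trans (s≤s (∣p∪q∣≤∣p∣+∣q∣ p q)) (≤-reflexive (sym (+-suc ∣ p ∣ ∣ q ∣)))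
∣p∪q∣≤∣p∣+∣q∣ (inside  ∷ p) (outside ∷ q) = s≤s (∣p∪q∣≤∣p∣+∣q∣ p q)
∣p∪q∣≤∣p∣+∣q∣ (inside  ∷ p) (inside  ∷ q) =
  s≤s (≤-trans (∣p∪q∣≤∣p∣+∣q∣ p q) (+-monoʳ-≤ ∣ p ∣ (n≤1+n ∣ q ∣)))

∣p∪q∣-disjoint : ∀ {n} (p q : Subset n) → Empty (p ∩ q) → ∣ p ∪ q ∣ ≡ ∣ p ∣ + ∣ q ∣
∣p∪q∣-disjoint []            []            _ = refl
∣p∪q∣-disjoint (outside ∷ p) (outside ∷ q) d = ∣p∪q∣-disjoint p q (drop-∷-Empty d)
∣p∪q∣-disjoint (outside ∷ p) (inside  ∷ q) d =
  trans (cong suc (∣p∪q∣-disjoint p q (drop-∷-Empty d))) (sym (+-suc ∣ p ∣ ∣ q ∣))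
∣p∪q∣-disjoint (inside  ∷ p) (outside ∷ q) d = cong suc (∣p∪q∣-disjoint p q (drop-∷-Empty d))
∣p∪q∣-disjoint (inside  ∷ p) (inside  ∷ q) d = contradiction (zero , here) d

∣p∪⁅x⁆∣ : ∀ {n} {p : Subset n} {x : Fin n} → x ∉ p → ∣ p ∪ ⁅ x ⁆ ∣ ≡ suc ∣ p ∣
∣p∪⁅x⁆∣ {p = p} {x} x∉p = begin
  ∣ p ∪ ⁅ x ⁆ ∣     ≡⟨ ∣p∪q∣-disjoint p ⁅ x ⁆ disjoint ⟩
  ∣ p ∣ + ∣ ⁅ x ⁆ ∣ ≡⟨ cong (∣ p ∣ +_) (∣⁅x⁆∣≡1 x) ⟩
  ∣ p ∣ + 1         ≡⟨ +-comm ∣ p ∣ 1 ⟩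
  suc ∣ p ∣         ∎
  where
  open ≡-Reasoning
  disjoint : Empty (p ∩ ⁅ x ⁆)
  disjoint (y , y∈p∩⁅x⁆) with x∈p∩q⁻ p ⁅ x ⁆ y∈p∩⁅x⁆
  ... | y∈p , y∈⁅x⁆ = x∉p (subst (_∈ p) (x∈⁅y⁆⇒x≡y x y∈⁅x⁆) y∈p)

subsetOfSize : ∀ {n} (p : Subset n) k → k ≤ ∣ p ∣ → ∃[ q ] (q ⊆ p × ∣ q ∣ ≡ k)
subsetOfSize {n} p zero _ = ⊥ , ⊥⊆ , ∣⊥∣≡0 n
subsetOfSize (outside ∷ p) (suc k) k<∣p∣ with subsetOfSize p (suc k) k<∣p∣
... | q , q⊆p , ∣q∣≡k = outside ∷ q , out⊆ q⊆p , ∣q∣≡k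
subsetOfSize (inside ∷ p) (suc k) (s≤s k≤∣p∣) with subsetOfSize p k k≤∣p∣
... | q , q⊆p , ∣q∣≡k = inside ∷ q , s⊆s q⊆p , cong suc ∣q∣≡k

select : ∀ {n} {P : Fin n → Set} → (∀ k → Dec (P k)) → Subset n
select {zero}  P? = []
select {suc n} P? with P? zero
... | yes _ = inside  ∷ select (P? ∘ suc)
... | no  _ = outside ∷ select (P? ∘ suc)

select⁻ : ∀ {n} {P : Fin n → Set} (P? : ∀ k → Dec (P k)) {k} → k ∈ select P? → P k
select⁻ {suc n} P? {k} k∈ with P? zero
select⁻ {suc n} P? {zero}  k∈          | yes P0 = P0
select⁻ {suc n} P? {suc k} (there k∈) | yes _  = select⁻ (P? ∘ suc) k∈
select⁻ {suc n} P? {suc k} (there k∈) | no  _  = select⁻ (P? ∘ suc) k∈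

select⁺ : ∀ {n} {P : Fin n → Set} (P? : ∀ k → Dec (P k)) {k} → P k → k ∈ select P?
select⁺ {suc n} P? {k} Pk with P? zero
select⁺ {suc n} P? {zero}  Pk | yes _   = here
select⁺ {suc n} P? {zero}  Pk | no  ¬P0 = contradiction Pk ¬P0
select⁺ {suc n} P? {suc k} Pk | yes _   = there (select⁺ (P? ∘ suc) Pk)
select⁺ {suc n} P? {suc k} Pk | no  _   = there (select⁺ (P? ∘ suc) Pk)

∈⋃⁻ : ∀ {m} {x : Fin m} (ps : List (Subset m)) → x ∈ ⋃ ps → ∃[ p ] (p ∈ₗ ps × x ∈ p)
∈⋃⁻ List.[]       x∈⋃ = contradiction x∈⋃ ∉⊥
∈⋃⁻ (p List.∷ ps) x∈⋃ with x∈p∪q⁻ p (⋃ ps) x∈⋃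
... | inj₁ x∈p = p , Any.here refl , x∈p
... | inj₂ x∈⋃ps with ∈⋃⁻ ps x∈⋃ps
...   | q , q∈ps , x∈q = q , Any.there q∈ps , x∈q

∈⋃⁺ : ∀ {m} {x : Fin m} {p} (ps : List (Subset m)) → p ∈ₗ ps → x ∈ p → x ∈ ⋃ ps
∈⋃⁺ (q List.∷ ps) (Any.here refl) x∈p  = p⊆p∪q (⋃ ps) x∈p
∈⋃⁺ (q List.∷ ps) (Any.there p∈ps) x∈p = q⊆p∪q q (⋃ ps) (∈⋃⁺ ps p∈ps x∈p)

∈⋃[]⁻ : ∀ {n m} {x : Fin m} (L : Subset n) (A : Fin n → Subset m) →
        x ∈ ⋃[ L ] A → ∃[ k ] (k ∈ L × x ∈ A k)
∈⋃[]⁻ {n} L A x∈⋃ with ∈⋃⁻ (List.map A (filter (_∈? L) (allFin n))) x∈⋃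
... | p , p∈As , x∈p with ∈-map∘filter⁻ A (_∈? L) {xs = allFin n} p∈As
...   | k , _ , p≡Ak , k∈L = k , k∈L , subst (_ ∈_) p≡Ak x∈p

∈⋃[]⁺ : ∀ {n m} {x : Fin m} (L : Subset n) (A : Fin n → Subset m) {k} →
        k ∈ L → x ∈ A k → x ∈ ⋃[ L ] A
∈⋃[]⁺ {n} L A {k} k∈L =
  ∈⋃⁺ (List.map A (filter (_∈? L) (allFin n))) (∈-map∘filter⁺ A (_∈? L) (k , ∈-allFin k , refl , k∈L))

-- The same union, by structural recursion on the index set; this is the
-- form on which sizes can be computed by induction.
⋃ʳ : ∀ {n m} → Subset n → (Fin n → Subset m) → Subset m
⋃ʳ []            A = ⊥
⋃ʳ (inside  ∷ L) A = A zero ∪ ⋃ʳ L (A ∘ suc)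
⋃ʳ (outside ∷ L) A = ⋃ʳ L (A ∘ suc)

∈⋃ʳ⁻ : ∀ {n m} {x : Fin m} (L : Subset n) (A : Fin n → Subset m) →
       x ∈ ⋃ʳ L A → ∃[ k ] (k ∈ L × x ∈ A k)
∈⋃ʳ⁻ []            A x∈⋃ = contradiction x∈⋃ ∉⊥
∈⋃ʳ⁻ (inside  ∷ L) A x∈⋃ with x∈p∪q⁻ (A zero) (⋃ʳ L (A ∘ suc)) x∈⋃
... | inj₁ x∈A0 = zero , here , x∈A0
... | inj₂ x∈⋃L with ∈⋃ʳ⁻ L (A ∘ suc) x∈⋃L
...   | k , k∈L , x∈Ak = suc k , there k∈L , x∈Ak
∈⋃ʳ⁻ (outside ∷ L) A x∈⋃ with ∈⋃ʳ⁻ L (A ∘ suc) x∈⋃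
... | k , k∈L , x∈Ak = suc k , there k∈L , x∈Ak

∈⋃ʳ⁺ : ∀ {n m} {x : Fin m} (L : Subset n) (A : Fin n → Subset m) {k} →
       k ∈ L → x ∈ A k → x ∈ ⋃ʳ L A
∈⋃ʳ⁺ (inside  ∷ L) A {zero}  here       x∈Ak = p⊆p∪q (⋃ʳ L (A ∘ suc)) x∈Ak
∈⋃ʳ⁺ (inside  ∷ L) A {suc k} (there k∈L) x∈Ak = q⊆p∪q (A zero) _ (∈⋃ʳ⁺ L (A ∘ suc) k∈L x∈Ak)
∈⋃ʳ⁺ (outside ∷ L) A {suc k} (there k∈L) x∈Ak = ∈⋃ʳ⁺ L (A ∘ suc) k∈L x∈Ak

⋃[]≡⋃ʳ : ∀ {n m} (L : Subset n) (A : Fin n → Subset m) → ⋃[ L ] A ≡ ⋃ʳ L A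
⋃[]≡⋃ʳ L A = ⊆-antisym
  (λ x∈⋃ → let k , k∈L , x∈Ak = ∈⋃[]⁻ L A x∈⋃ in ∈⋃ʳ⁺ L A k∈L x∈Ak)
  (λ x∈⋃ → let k , k∈L , x∈Ak = ∈⋃ʳ⁻ L A x∈⋃ in ∈⋃[]⁺ L A k∈L x∈Ak)

PairwiseDisjoint : ∀ {n m} → (Fin n → Subset m) → Set
PairwiseDisjoint A = ∀ i j → i ≢ j → Empty (A i ∩ A j)

disjoint-⊆ : ∀ {n m} {A B : Fin n → Subset m} →
             (∀ k → B k ⊆ A k) → PairwiseDisjoint A → PairwiseDisjoint B
disjoint-⊆ B⊆A disjA i j i≢j (x , x∈Bi∩Bj) with x∈p∩q⁻ _ _ x∈Bi∩Bj
... | x∈Bi , x∈Bj = disjA i j i≢j (x , x∈p∩q⁺ (B⊆A i x∈Bi , B⊆A j x∈Bj))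

disjoint-tail : ∀ {n m} {A : Fin (suc n) → Subset m} → PairwiseDisjoint A → PairwiseDisjoint (A ∘ suc)
disjoint-tail disjA i j i≢j = disjA (suc i) (suc j) (i≢j ∘ Fin-suc-injective)

card-⋃-lower : ∀ {n m} (L : Subset n) (A : Fin n → Subset m) {c} →
  PairwiseDisjoint A → (∀ k → k ∈ L → c ≤ ∣ A k ∣) → c * ∣ L ∣ ≤ ∣ ⋃[ L ] A ∣
card-⋃-lower L A {c} disjA large rewrite ⋃[]≡⋃ʳ L A = lower L A disjA large
  where
  open ≤-Reasoning
  lower : ∀ {n} (L : Subset n) A → PairwiseDisjoint A →
          (∀ k → k ∈ L → c ≤ ∣ A k ∣) → c * ∣ L ∣ ≤ ∣ ⋃ʳ L A ∣
  lower []            A _     _     = ≤-trans (≤-reflexive (*-zeroʳ c)) z≤n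
  lower (outside ∷ L) A disjA large =
    lower L (A ∘ suc) (disjoint-tail disjA) (λ k k∈L → large (suc k) (there k∈L))
  lower (inside ∷ L) A disjA large = begin
    c * suc ∣ L ∣                  ≡⟨ *-suc c ∣ L ∣ ⟩
    c + c * ∣ L ∣                  ≤⟨ +-mono-≤ (large zero here) (lower L (A ∘ suc) (disjoint-tail disjA) (λ k k∈L → large (suc k) (there k∈L))) ⟩
    ∣ A zero ∣ + ∣ ⋃ʳ L (A ∘ suc) ∣ ≡⟨ sym (∣p∪q∣-disjoint (A zero) (⋃ʳ L (A ∘ suc)) head-disjoint) ⟩
    ∣ ⋃ʳ (inside ∷ L) A ∣          ∎
    where
    head-disjoint : Empty (A zero ∩ ⋃ʳ L (A ∘ suc))
    head-disjoint (x , x∈∩) with x∈p∩q⁻ (A zero) _ x∈∩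
    ... | x∈A0 , x∈⋃ with ∈⋃ʳ⁻ L (A ∘ suc) x∈⋃
    ...   | k , _ , x∈Ak = disjA zero (suc k) (λ ()) (x , x∈p∩q⁺ (x∈A0 , x∈Ak))

card-⋃-upper : ∀ {n m} (L : Subset n) (A : Fin n → Subset m) {c} →
  (∀ k → k ∈ L → ∣ A k ∣ ≤ c) → ∣ ⋃[ L ] A ∣ ≤ c * ∣ L ∣
card-⋃-upper {m = m} L A {c} small rewrite ⋃[]≡⋃ʳ L A = upper L A small
  where
  open ≤-Reasoning
  upper : ∀ {n} (L : Subset n) A → (∀ k → k ∈ L → ∣ A k ∣ ≤ c) → ∣ ⋃ʳ L A ∣ ≤ c * ∣ L ∣
  upper []            A _     = ≤-reflexive (trans (∣⊥∣≡0 m) (sym (*-zeroʳ c)))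
  upper (outside ∷ L) A small = upper L (A ∘ suc) (λ k k∈L → small (suc k) (there k∈L))
  upper (inside ∷ L) A small = begin
    ∣ ⋃ʳ (inside ∷ L) A ∣           ≤⟨ ∣p∪q∣≤∣p∣+∣q∣ (A zero) (⋃ʳ L (A ∘ suc)) ⟩
    ∣ A zero ∣ + ∣ ⋃ʳ L (A ∘ suc) ∣ ≤⟨ +-mono-≤ (small zero here) (upper L (A ∘ suc) (λ k k∈L → small (suc k) (there k∈L))) ⟩
    c + c * ∣ L ∣                   ≡⟨ sym (*-suc c ∣ L ∣) ⟩
    c * suc ∣ L ∣                   ∎

meeting : ∀ {n m} → (Fin n → Subset m) → Subset m → Subset n
meeting A D = select (λ k → nonempty? (A k ∩ D))

-- Each disjoint member meeting D uses up an element of D, so at most |D| do.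
∣meeting∣≤∣D∣ : ∀ {n m} {A : Fin n → Subset m} → PairwiseDisjoint A →
                ∀ D → ∣ meeting A D ∣ ≤ ∣ D ∣
∣meeting∣≤∣D∣ {n} {m} {A} disjA D = begin
  ∣ meeting A D ∣                       ≡⟨ sym (*-identityˡ _) ⟩
  1 * ∣ meeting A D ∣                   ≤⟨ card-⋃-lower (meeting A D) A∩D disj∩ meets ⟩
  ∣ ⋃[ meeting A D ] A∩D ∣              ≤⟨ p⊆q⇒∣p∣≤∣q∣ ⋃⊆D ⟩
  ∣ D ∣                                 ∎
  where
  open ≤-Reasoning
  A∩D : Fin n → Subset m
  A∩D k = A k ∩ D
  disj∩ : PairwiseDisjoint A∩D
  disj∩ = disjoint-⊆ (λ k → p∩q⊆p (A k) D) disjA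
  meets : ∀ k → k ∈ meeting A D → 1 ≤ ∣ A∩D k ∣
  meets k k∈ = member⇒0<∣p∣ (proj₂ (select⁻ (λ k → nonempty? (A k ∩ D)) k∈))
  ⋃⊆D : ⋃[ meeting A D ] A∩D ⊆ D
  ⋃⊆D x∈⋃ = let _ , _ , x∈Ak∩D = ∈⋃[]⁻ (meeting A D) A∩D x∈⋃ in proj₂ (x∈p∩q⁻ _ D x∈Ak∩D)

avoiding : ∀ {n m} {A : Fin n → Subset m} → PairwiseDisjoint A → ∀ D k → k + ∣ D ∣ ≤ n →
           ∃[ R ] (∣ R ∣ ≡ k × (∀ j → j ∈ R → Empty (A j ∩ D)))
avoiding {n} {A = A} disjA D k k+∣D∣≤n =
  let R , R⊆∁meeting , ∣R∣≡k = subsetOfSize (∁ (meeting A D)) k k≤∣∁meeting∣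
  in R , ∣R∣≡k , λ j j∈R Aj∩D≠∅ →
       x∈∁p⇒x∉p (R⊆∁meeting j∈R) (select⁺ (λ k → nonempty? (A k ∩ D)) Aj∩D≠∅)
  where
  open ≤-Reasoning
  k≤∣∁meeting∣ : k ≤ ∣ ∁ (meeting A D) ∣
  k≤∣∁meeting∣ = begin
    k                     ≤⟨ m+n≤o⇒m≤o∸n k k+∣D∣≤n ⟩
    n ∸ ∣ D ∣             ≤⟨ ∸-monoʳ-≤ n (∣meeting∣≤∣D∣ disjA D) ⟩
    n ∸ ∣ meeting A D ∣   ≡⟨ sym (∣∁p∣≡n∸∣p∣ (meeting A D)) ⟩
    ∣ ∁ (meeting A D) ∣   ∎

-- Matroids: bases and orthogonality of circuits and cocircuits

module MatroidFacts {m : ℕ} (M : Matroid m) where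
  open Matroid M

  -- No independent set is larger than a basis (else the basis could be augmented).
  indep≤basis : ∀ {B I} → IsBasis M B → Indep I → ∣ I ∣ ≤ ∣ B ∣
  indep≤basis {B} {I} (indepB , maximalB) indepI with ∣ I ∣ ≤? ∣ B ∣
  ... | yes ∣I∣≤∣B∣ = ∣I∣≤∣B∣
  ... | no  ∣I∣≰∣B∣ with indep-augment indepB indepI (≰⇒> ∣I∣≰∣B∣)
  ...   | x , _ , x∉B , indepB∪x =
    contradiction (subst (x ∈_) (maximalB _ indepB∪x (p⊆p∪q ⁅ x ⁆)) (q⊆p∪q B ⁅ x ⁆ (x∈⁅x⁆ x))) x∉B

  large-indep⇒basis : ∀ {B K} → IsBasis M B → Indep K → ∣ B ∣ ≤ ∣ K ∣ → IsBasis M K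
  large-indep⇒basis basisB indepK ∣B∣≤∣K∣ = indepK , λ J indepJ K⊆J →
    sym (⊆-card-≡ K⊆J (≤-trans (indep≤basis basisB indepJ) ∣B∣≤∣K∣))

  extend-within : ∀ {I J} → Indep I → Indep J → ∣ I ∣ ≤ ∣ J ∣ →
                  ∃[ K ] (Indep K × I ⊆ K × K ⊆ I ∪ J × ∣ J ∣ ≤ ∣ K ∣)
  extend-within {I} {J} indepI indepJ ∣I∣≤∣J∣ =
    let gap , ∣I∣+gap≡∣J∣ = m≤n⇒∃[o]m+o≡n ∣I∣≤∣J∣ in extend gap indepI ∣I∣+gap≡∣J∣
    where
    extend : ∀ gap {I} → Indep I → ∣ I ∣ + gap ≡ ∣ J ∣ →
             ∃[ K ] (Indep K × I ⊆ K × K ⊆ I ∪ J × ∣ J ∣ ≤ ∣ K ∣)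
    extend zero {I} indepI ∣I∣+0≡∣J∣ =
      I , indepI , ⊆-refl , p⊆p∪q J , ≤-reflexive (trans (sym ∣I∣+0≡∣J∣) (+-identityʳ ∣ I ∣))
    extend (suc gap) {I} indepI ∣I∣+gap≡∣J∣
      with indep-augment indepI indepJ (subst (∣ I ∣ <_) ∣I∣+gap≡∣J∣ (m<m+n ∣ I ∣ (s≤s z≤n)))
    ... | x , x∈J , x∉I , indepI∪x
      with extend gap indepI∪x (trans (cong (_+ gap) (∣p∪⁅x⁆∣ x∉I)) (trans (sym (+-suc ∣ I ∣ gap)) ∣I∣+gap≡∣J∣))
    ...   | K , indepK , I∪x⊆K , K⊆I∪x∪J , ∣J∣≤∣K∣ =
      K , indepK , I∪x⊆K ∘ p⊆p∪q ⁅ x ⁆ ,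
      ∪-least (∪-least (p⊆p∪q J) (⁅x⁆⊆ (q⊆p∪q I J x∈J))) (q⊆p∪q I J) ∘ K⊆I∪x∪J , ∣J∣≤∣K∣

  -- Extend C − e to a basis K using a basis B disjoint from D − e; then K
  -- misses e (else C ⊆ K) and misses D − e, so D is co-independent.
  orthogonal : ∀ {C D e} → IsCircuit M C → IsCocircuit M D → e ∈ C → e ∈ D →
               ¬ (∀ x → x ∈ C → x ∈ D → x ≡ e)
  orthogonal {C} {D} {e} (dependentC , minimalC) (notCoindepD , minimalD) e∈C e∈D only-e
    with minimalC (C - e) (x∈p⇒p-x⊂p e∈C) | minimalD (D - e) (x∈p⇒p-x⊂p e∈D)
  ... | indepC-e | B , basisB , D-e⊆∁B
    with extend-within indepC-e (proj₁ basisB) (indep≤basis basisB indepC-e)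
  ... | K , indepK , C-e⊆K , K⊆C-e∪B , ∣B∣≤∣K∣ =
    notCoindepD (K , large-indep⇒basis basisB indepK ∣B∣≤∣K∣ , D⊆∁K)
    where
    e∉K : e ∉ K
    e∉K e∈K = dependentC (indep-subset indepK C⊆K)
      where
      C⊆K : C ⊆ K
      C⊆K {z} z∈C with z ≟ᶠ e
      ... | yes refl = e∈K
      ... | no  z≢e  = C-e⊆K (x∈p∧x≢y⇒x∈p-y z∈C z≢e)
    D⊆∁K : D ⊆ ∁ K
    D⊆∁K {y} y∈D with y ∈? K
    ... | no  y∉K = x∉p⇒x∈∁p y∉K
    ... | yes y∈K with y ≟ᶠ e
    ...   | yes refl = contradiction y∈K e∉K
    ...   | no  y≢e with x∈p∪q⁻ (C - e) B (K⊆C-e∪B y∈K)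
    ...     | inj₁ y∈C-e = contradiction (only-e y (p─q⊆p C ⁅ e ⁆ y∈C-e) y∈D) y≢e
    ...     | inj₂ y∈B   = contradiction y∈B (x∈∁p⇒x∉p (D-e⊆∁B (x∈p∧x≢y⇒x∈p-y y∈D y≢e)))

-- Echidnas

module EchidnaFacts {m : ℕ} (M : Matroid m) (t : ℕ) {n : ℕ} (S : Fin n → Subset m)
                    (echidna : IsEchidna M t S) where
  open MatroidFacts M

  blockSize : ∀ i → ∣ S i ∣ ≡ 2
  blockSize = proj₁ (proj₁ echidna)

  blocksDisjoint : PairwiseDisjoint S
  blocksDisjoint = proj₂ (proj₁ echidna)

  circuits : ∀ I → ∣ I ∣ ≡ t → IsCircuit M (⋃[ I ] S)
  circuits = proj₂ echidna

  blockNonempty : ∀ i → Nonempty (S i)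
  blockNonempty i = 0<∣p∣⇒nonempty (S i) (subst (0 <_) (sym (blockSize i)) (s≤s z≤n))

  rep : Fin n → Fin m
  rep i = proj₁ (blockNonempty i)

  rep∈S : ∀ i → rep i ∈ S i
  rep∈S i = proj₂ (blockNonempty i)

  transversal : Subset n → Subset m
  transversal I = ⋃[ I ] (λ i → ⁅ rep i ⁆)

  ∣transversal∣ : ∀ I → ∣ transversal I ∣ ≡ ∣ I ∣
  ∣transversal∣ I = ≤-antisym
    (≤-trans (card-⋃-upper I reps (λ k _ → ≤-reflexive (∣⁅x⁆∣≡1 (rep k)))) (≤-reflexive (*-identityˡ _)))
    (≤-trans (≤-reflexive (sym (*-identityˡ _)))
             (card-⋃-lower I reps (disjoint-⊆ (λ k → ⁅x⁆⊆ (rep∈S k)) blocksDisjoint)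
                                  (λ k _ → ≤-reflexive (sym (∣⁅x⁆∣≡1 (rep k))))))
    where
    reps : Fin n → Subset m
    reps i = ⁅ rep i ⁆

  -- If t − 1 blocks avoid a cocircuit D, every block meeting D lies in D:
  -- otherwise that block and the avoiding ones form a circuit meeting D in
  -- exactly one element, against orthogonality.
  block⊆cocircuit : ∀ {D} → IsCocircuit M D → ∀ R → suc ∣ R ∣ ≡ t →
    (∀ k → k ∈ R → Empty (S k ∩ D)) → ∀ i → Nonempty (S i ∩ D) → S i ⊆ D
  block⊆cocircuit {D} cocircuitD R ∣R∣+1≡t R-avoids i (e , e∈Si∩D) {y} y∈Si with y ∈? D
  ... | yes y∈D = y∈D
  ... | no  y∉D = contradiction only-e (orthogonal (circuits J ∣J∣≡t) cocircuitD e∈C (proj₂ e∈Si×D))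
    where
    e∈Si×D : e ∈ S i × e ∈ D
    e∈Si×D = x∈p∩q⁻ (S i) D e∈Si∩D
    J : Subset n
    J = R ∪ ⁅ i ⁆
    ∣J∣≡t : ∣ J ∣ ≡ t
    ∣J∣≡t = trans (∣p∪⁅x⁆∣ (λ i∈R → R-avoids i i∈R (e , e∈Si∩D))) ∣R∣+1≡t
    e∈C : e ∈ ⋃[ J ] S
    e∈C = ∈⋃[]⁺ J S (q⊆p∪q R ⁅ i ⁆ (x∈⁅x⁆ i)) (proj₁ e∈Si×D)
    ∣Si∩D∣≤1 : ∣ S i ∩ D ∣ ≤ 1
    ∣Si∩D∣≤1 = s≤s⁻¹ (begin-strict
      ∣ S i ∩ D ∣ ≤⟨ p⊆q⇒∣p∣≤∣q∣ Si∩D⊆Si-y ⟩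
      ∣ S i - y ∣ <⟨ x∈p⇒∣p-x∣<∣p∣ y∈Si ⟩
      ∣ S i ∣     ≡⟨ blockSize i ⟩
      2           ∎)
      where
      open ≤-Reasoning
      Si∩D⊆Si-y : S i ∩ D ⊆ S i - y
      Si∩D⊆Si-y x∈Si∩D with x∈p∩q⁻ (S i) D x∈Si∩D
      ... | x∈Si , x∈D = x∈p∧x≢y⇒x∈p-y x∈Si (λ x≡y → y∉D (subst (_∈ D) x≡y x∈D))
    only-e : ∀ x → x ∈ ⋃[ J ] S → x ∈ D → x ≡ e
    only-e x x∈C x∈D with ∈⋃[]⁻ J S x∈C
    ... | k , k∈J , x∈Sk with x∈p∪q⁻ R ⁅ i ⁆ k∈J
    ...   | inj₁ k∈R   = ⊥-elim (R-avoids k k∈R (x , x∈p∩q⁺ (x∈Sk , x∈D)))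
    ...   | inj₂ k∈⁅i⁆ = ∣p∣≤1⇒unique ∣Si∩D∣≤1
                           (x∈p∩q⁺ (subst (λ j → x ∈ S j) (x∈⁅y⁆⇒x≡y i k∈⁅i⁆) x∈Sk , x∈D)) e∈Si∩D

  blocks-fill : ∀ {D} I → ∣ D ∣ ≤ 2 * ∣ I ∣ → (∀ i → i ∈ I → S i ⊆ D) → ⋃[ I ] S ≡ D
  blocks-fill {D} I ∣D∣≤2∣I∣ blocks⊆D = ⊆-card-≡ ⋃⊆D
    (≤-trans ∣D∣≤2∣I∣ (card-⋃-lower I S blocksDisjoint (λ k _ → ≤-reflexive (sym (blockSize k)))))
    where
    ⋃⊆D : ⋃[ I ] S ⊆ D
    ⋃⊆D x∈⋃ = let k , k∈I , x∈Sk = ∈⋃[]⁻ I S x∈⋃ in blocks⊆D k k∈I x∈Sk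

-- The theorem.  Write t = t′ + 1; then n ≥ 3t − 1 says exactly t′ + 2t ≤ n.
lemma4p3 : ∀ {m : ℕ} (M : Matroid m) (t : ℕ) → 1 ≤ t → HasProperty M t (2 * t) →
    ∀ {n : ℕ} (S : Fin n → Subset m) → IsEchidna M t S → 3 * t ∸ 1 ≤ n →
    IsCoechidna M t S
lemma4p3 M (suc t′) _ property {n} S echidna 3t-1≤n = proj₁ echidna , union-is-cocircuit
  where
  open EchidnaFacts M (suc t′) S echidna
  union-is-cocircuit : ∀ I → ∣ I ∣ ≡ suc t′ → IsCocircuit M (⋃[ I ] S)
  union-is-cocircuit I ∣I∣≡t
    with proj₂ (property (transversal I) (trans (∣transversal∣ I) ∣I∣≡t))
  ... | D , cocircuitD , transversal⊆D , ∣D∣≡2t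
    with avoiding blocksDisjoint D t′ (subst (λ d → t′ + d ≤ n) (sym ∣D∣≡2t) 3t-1≤n)
  ... | R , ∣R∣≡t′ , R-avoids =
    subst (IsCocircuit M) (sym (blocks-fill I ∣D∣≤2∣I∣ blocks⊆D)) cocircuitD
    where
    ∣D∣≤2∣I∣ : ∣ D ∣ ≤ 2 * ∣ I ∣
    ∣D∣≤2∣I∣ = ≤-reflexive (trans ∣D∣≡2t (cong (2 *_) (sym ∣I∣≡t)))
    blocks⊆D : ∀ i → i ∈ I → S i ⊆ D
    blocks⊆D i i∈I = block⊆cocircuit cocircuitD R (cong suc ∣R∣≡t′) R-avoids i
      (rep i , x∈p∩q⁺ (rep∈S i , transversal⊆D (∈⋃[]⁺ I (λ j → ⁅ rep j ⁆) i∈I (x∈⁅x⁆ (rep i)))))
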